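{- Let $X$ be a multigraph (multiple edges allowed) with no isolated vertices and let $\mathrm{TR}(X)$ be a generalized truncation of $X$ with maximum valency $\Delta$. If every constituent $\mathrm{con}(v)$ of $\mathrm{TR}(X)$ that contains a vertex of valency $\Delta$ in $\mathrm{TR}(X)$ is class I (as a graph in its own right), then $\mathrm{TR}(X)$ is class I.
   Context: Generalized truncation of $X$: for each edge $e=[u,v]$ of $X$ take a new edge (these form a matching $M_F$) whose two ends are labelled $u$ and $v$. For each vertex $v$ of $X$, the cluster $\mathrm{cl}(v)$ is the set of ends labelled $v$; insert an arbitrary simple graph $\mathrm{con}(v)$ (the constituent at $v$) on $\mathrm{cl}(v)$. The graph $\mathrm{TR}(X)=M_F\cup\bigcup_v\mathrm{con}(v)$ is a generalized truncation. A graph is class I if its chromatic index (minimum number of colors in a proper edge coloring) equals its maximum valency. -}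

module Defs where

open import Data.Nat using (ℕ; _≤_; _⊔_; _+_)
open import Data.Fin using (Fin; _≟_; splitAt)
open import Data.Bool using (Bool; true; false; if_then_else_; _∨_)
open import Data.List using (List; map; foldr; allFin)
open import Data.Nat.ListAction using (sum)
open import Data.Bool.ListAction using (any)
open import Data.Sum using (_⊎_; inj₁; inj₂; [_,_])
open import Data.Product using (Σ; ∃; _×_; _,_)
open import Relation.Nullary using (¬_)
open import Relation.Nullary.Decidable using (⌊_⌋)
open import Relation.Binary.PropositionalEquality using (_≡_; _≢_)

Adj : ℕ → Set
Adj N = Fin N → Fin N → Bool

IsSimple : ∀ {N} → Adj N → Set
IsSimple {N} A = (∀ u v → A u v ≡ A v u) × (∀ v → A v v ≡ false)

degree : ∀ {N} → Adj N → Fin N → ℕ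
degree {N} A v = sum (map (λ w → if A v w then 1 else 0) (allFin N))

maxValency : ∀ {N} → Adj N → ℕ
maxValency {N} A = foldr _⊔_ 0 (map (degree A) (allFin N))

record EdgeColouring {N} (A : Adj N) (k : ℕ) : Set where
  field
    col    : ∀ v w → A v w ≡ true → Fin k
    col-sym : ∀ v w (p : A v w ≡ true) (q : A w v ≡ true) → col v w p ≡ col w v q
    proper : ∀ u v w (p : A u v ≡ true) (q : A u w ≡ true) →
             v ≢ w → col u v p ≢ col u w q

IsChromaticIndex : ∀ {N} → Adj N → ℕ → Set
IsChromaticIndex A k = EdgeColouring A k × (∀ j → EdgeColouring A j → k ≤ j)

ClassI : ∀ {N} → Adj N → Set
ClassI A = IsChromaticIndex A (maxValency A)

record Multigraph : Set where
  field
    n m      : ℕ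
    src tgt  : Fin m → Fin n
    loopless : ∀ e → src e ≢ tgt e

open Multigraph public

NoIsolatedVertices : Multigraph → Set
NoIsolatedVertices X = ∀ v → ∃ λ e → (src X e ≡ v) ⊎ (tgt X e ≡ v)

-- Ends ("darts") of the new edges: for edge e, end inj₁ e (labelled src e)
-- and end inj₂ e (labelled tgt e); encoded as Fin (m + m) via splitAt.
Dart : Multigraph → ℕ
Dart X = m X + m X

label : (X : Multigraph) → Fin (Dart X) → Fin (n X)
label X d = [ src X , tgt X ] (splitAt (m X) d)

matchS : ∀ {m} → Fin m ⊎ Fin m → Fin m ⊎ Fin m → Bool
matchS (inj₁ e) (inj₂ e') = ⌊ e ≟ e' ⌋
matchS (inj₂ e) (inj₁ e') = ⌊ e ≟ e' ⌋
matchS _ _ = false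

matching : (X : Multigraph) → Adj (Dart X)
matching X d d' = matchS (splitAt (m X) d) (splitAt (m X) d')

-- Generalized truncation data: a simple graph con(v) on the cluster cl(v)
-- (represented on all darts, with every edge inside cl(v)).
record GenTrunc (X : Multigraph) : Set where
  field
    con      : Fin (n X) → Adj (Dart X)
    con-simple : ∀ v → IsSimple (con v)
    con-supp : ∀ v d d' → con v d d' ≡ true → (label X d ≡ v) × (label X d' ≡ v)

open GenTrunc public

TR : (X : Multigraph) → GenTrunc X → Adj (Dart X)
TR X T d d' = matching X d d' ∨ any (λ v → con T v d d') (allFin (n X))

{-# OPTIONS --safe #-}

-- Let Δ = D + 1 be the maximum valency of TR(X).  Every vertex lies on exactly one edge of the
-- matching M_F, so its valency in its constituent is one less than in TR(X).  A constituent with a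
-- vertex of valency Δ therefore has maximum valency D and, being class I, is D-edge-colourable; every
-- other constituent has maximum valency below D and is D-edge-colourable by Vizing's theorem.  Giving
-- all of M_F one further colour yields a Δ-edge-colouring of TR(X), and no proper edge colouring uses fewer
-- colours than the maximum valency.  (X need not be free of isolated vertices.)  Vizing's theorem is proved by
-- colouring one edge at a time with the fan and Kempe chain argument.
module Submission where

open import Defs
open import Data.Bool as Bool using (Bool; true; false; if_then_else_; _∧_; _∨_; not)
open import Data.Bool.ListAction using (any)
open import Data.Bool.Properties using (T-≡; ∧-identityʳ)
open import Data.Empty using (⊥; ⊥-elim)
open import Data.Fin as Fin using (Fin; zero; suc; _≟_; toℕ; fromℕ<; inject≤; splitAt; join; fromℕ; inject₁)
open import Data.Fin.Permutation.Components using (transpose; transpose-inverse)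
open import Data.Fin.Properties as Fin
  using (any?; all?; ¬∀⟶∃¬; pigeonhole; inject≤-injective; splitAt-join; join-splitAt
        ; fromℕ≢inject₁; inject₁-injective)
open import Data.List using (List; []; _∷_; tabulate; foldr; allFin; cartesianProduct)
open import Data.List.Membership.Propositional using (_∈_)
open import Data.List.Membership.Propositional.Properties using (∈-allFin; ∈-cartesianProduct⁺)
open import Data.List.Properties using (map-tabulate)
open import Data.List.Relation.Unary.Any as Any using (here; there; satisfied)
open import Data.List.Relation.Unary.Any.Properties using (any⁺; any⁻)
open import Data.Maybe as Maybe using (Maybe; just; nothing; fromMaybe)
open import Data.Maybe.Properties using (just-injective; map-injective; map-nothing; ≡-dec)
open import Data.Nat as ℕ using (ℕ; zero; suc; _≤_; _<_; z≤n; s≤s; _+_; _∸_; _⊔_)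
open import Data.Nat.ListAction using (sum)
open import Data.Nat.Properties as ℕ using ()
open import Algebra.Properties.CommutativeSemigroup ℕ.+-commutativeSemigroup using (x∙yz≈y∙xz)
open import Data.Product using (∃; _×_; _,_; proj₁; proj₂)
open import Data.Sum using (_⊎_; inj₁; inj₂; [_,_]; swap; map₁)
open import Function using (_∘_; id; _⇔_; mk⇔; Equivalence)
open import Relation.Binary using (tri<; tri≈; tri>)
open import Relation.Binary.PropositionalEquality
  using (_≡_; _≢_; refl; sym; trans; cong; subst; subst₂; module ≡-Reasoning)
open import Relation.Nullary using (¬_; Dec; yes; no; ¬?; does)
open import Relation.Nullary.Decidable
  using (⌊_⌋; _×-dec_; _⊎-dec_; isYes≗does; dec-true; dec-false; does-⇔; toWitness; decidable-stable)

private variable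
  N K k : ℕ

-- Partial edge colourings of the complete graph on Fin N

PartialColouring : ℕ → ℕ → Set
PartialColouring N K = Fin N → Fin N → Maybe (Fin K)

record IsProper (c : PartialColouring N K) : Set where
  field
    symmetric   : ∀ u v → c u v ≡ c v u
    irreflexive : ∀ u → c u u ≡ nothing
    unique      : ∀ u v w a → c u v ≡ just a → c u w ≡ just a → v ≡ w
open IsProper public

Misses : PartialColouring N K → Fin N → Fin K → Set
Misses c u a = ∀ w → c u w ≢ just a

Coloured : PartialColouring N K → Fin N → Fin N → Set
Coloured c u v = c u v ≢ nothing

Joins : Fin N → Fin N → Fin N → Fin N → Set
Joins x y u v = (u ≡ x × v ≡ y) ⊎ (u ≡ y × v ≡ x)

record Extends (c c′ : PartialColouring N K) (x y : Fin N) : Set where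
  field
    keeps : ∀ u v → Coloured c u v → Coloured c′ u v
    adds  : Coloured c′ x y
    only  : ∀ u v → Coloured c′ u v → Coloured c u v ⊎ Joins x y u v
open Extends public

ProperExtension : PartialColouring N K → Fin N → Fin N → Set
ProperExtension c x y = ∃ λ c′ → IsProper c′ × Extends c c′ x y

just≢nothing : ∀ {A : Set} {a : A} → just a ≢ nothing
just≢nothing ()

joins? : (x y u v : Fin N) → Dec (Joins x y u v)
joins? x y u v = (u ≟ x ×-dec v ≟ y) ⊎-dec (u ≟ y ×-dec v ≟ x)

joins-swap : {x y u v : Fin N} → Joins x y u v → Joins x y v u
joins-swap (inj₁ (a , b)) = inj₂ (b , a)
joins-swap (inj₂ (a , b)) = inj₁ (b , a)

¬joins-left : {x y u v : Fin N} → u ≢ x → u ≢ y → ¬ Joins x y u v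
¬joins-left ux uy (inj₁ (a , _)) = ux a
¬joins-left ux uy (inj₂ (a , _)) = uy a

¬joins-right : {x y u v : Fin N} → v ≢ x → v ≢ y → ¬ Joins x y u v
¬joins-right vx vy = ¬joins-left vx vy ∘ joins-swap

recolour : PartialColouring N K → Fin N → Fin N → Maybe (Fin K) → PartialColouring N K
recolour c x y m u v with joins? x y u v
... | yes _ = m
... | no _  = c u v

module _ (c : PartialColouring N K) (x y : Fin N) (m : Maybe (Fin K)) where

  recolour-on : ∀ {u v} → Joins x y u v → recolour c x y m u v ≡ m
  recolour-on {u} {v} j with joins? x y u v
  ... | yes _ = refl
  ... | no ¬j = ⊥-elim (¬j j)

  recolour-off : ∀ {u v} → ¬ Joins x y u v → recolour c x y m u v ≡ c u v
  recolour-off {u} {v} ¬j with joins? x y u v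
  ... | yes j = ⊥-elim (¬j j)
  ... | no _  = refl

  recolour-edge : recolour c x y m x y ≡ m
  recolour-edge = recolour-on (inj₁ (refl , refl))

  recolour-symmetric : (∀ u v → c u v ≡ c v u) → ∀ u v → recolour c x y m u v ≡ recolour c x y m v u
  recolour-symmetric sym-c u v with joins? x y u v | joins? x y v u
  ... | yes _ | yes _  = refl
  ... | yes j | no ¬j  = ⊥-elim (¬j (joins-swap j))
  ... | no ¬j | yes j  = ⊥-elim (¬j (joins-swap j))
  ... | no _  | no _   = sym-c u v

  recolour-misses : ∀ {u a} → m ≢ just a → Misses c u a → Misses (recolour c x y m) u a
  recolour-misses {u} m≢a miss w with joins? x y u w
  ... | yes _ = m≢a
  ... | no _  = miss w

  recolour-misses-away : ∀ {u a} → u ≢ x → u ≢ y → Misses c u a → Misses (recolour c x y m) u a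
  recolour-misses-away ux uy miss w e = miss w (trans (sym (recolour-off (¬joins-left ux uy))) e)

  recolour-coloured : ∀ {u v} → Coloured (recolour c x y m) u v → Coloured c u v ⊎ Joins x y u v
  recolour-coloured {u} {v} col with joins? x y u v
  ... | yes j = inj₂ j
  ... | no _  = inj₁ col

uncolour-proper : {c : PartialColouring N K} (x y : Fin N) → IsProper c → IsProper (recolour c x y nothing)
uncolour-proper {c = c} x y P = record
  { symmetric   = recolour-symmetric c x y nothing (symmetric P)
  ; irreflexive = loop
  ; unique      = uniq
  }
  where
  loop : ∀ u → recolour c x y nothing u u ≡ nothing
  loop u with joins? x y u u
  ... | yes _ = refl
  ... | no _  = irreflexive P u
  uniq : ∀ u v w a → recolour c x y nothing u v ≡ just a → recolour c x y nothing u w ≡ just a → v ≡ w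
  uniq u v w a p q with joins? x y u v | joins? x y u w
  ... | yes _ | _     = ⊥-elim (just≢nothing (sym p))
  ... | no _  | yes _ = ⊥-elim (just≢nothing (sym q))
  ... | no _  | no _  = unique P u v w a p q

uncolour-frees : {c : PartialColouring N K} {x y : Fin N} {a : Fin K} →
  IsProper c → c x y ≡ just a → Misses (recolour c x y nothing) x a
uncolour-frees {c = c} {x} {y} P cxy w e with joins? x y x w
... | yes _ = just≢nothing (sym e)
... | no ¬j = ¬j (inj₁ (refl , unique P x w y _ e cxy))

colour-proper : {c : PartialColouring N K} {x y : Fin N} (a : Fin K) → IsProper c → x ≢ y →
  Misses c x a → Misses c y a → IsProper (recolour c x y (just a))
colour-proper {c = c} {x} {y} a P x≢y mx my = record
  { symmetric   = recolour-symmetric c x y (just a) (symmetric P)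
  ; irreflexive = loop
  ; unique      = uniq
  }
  where
  loop : ∀ u → recolour c x y (just a) u u ≡ nothing
  loop u with joins? x y u u
  ... | yes (inj₁ (p , q)) = ⊥-elim (x≢y (trans (sym p) q))
  ... | yes (inj₂ (p , q)) = ⊥-elim (x≢y (trans (sym q) p))
  ... | no _ = irreflexive P u
  end-misses : ∀ {u w} → Joins x y u w → Misses c u a
  end-misses (inj₁ (refl , _)) = mx
  end-misses (inj₂ (refl , _)) = my
  uniq : ∀ u v w b → recolour c x y (just a) u v ≡ just b → recolour c x y (just a) u w ≡ just b → v ≡ w
  uniq u v w b p q with joins? x y u v | joins? x y u w
  ... | yes (inj₁ (_ , r)) | yes (inj₁ (_ , s)) = trans r (sym s)
  ... | yes (inj₂ (_ , r)) | yes (inj₂ (_ , s)) = trans r (sym s)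
  ... | yes (inj₁ (r , _)) | yes (inj₂ (s , _)) = ⊥-elim (x≢y (trans (sym r) s))
  ... | yes (inj₂ (r , _)) | yes (inj₁ (s , _)) = ⊥-elim (x≢y (trans (sym s) r))
  ... | yes j | no _ with p
  ...   | refl = ⊥-elim (end-misses j w q)
  uniq u v w b p q | no _ | yes j with q
  ...   | refl = ⊥-elim (end-misses j v p)
  uniq u v w b p q | no _ | no _ = unique P u v w b p q

colour-extends : {c : PartialColouring N K} {x y : Fin N} (a : Fin K) → Extends c (recolour c x y (just a)) x y
colour-extends {c = c} {x} {y} a = record
  { keeps = keep
  ; adds  = λ e → just≢nothing (trans (sym (recolour-edge c x y (just a))) e)
  ; only  = λ u v → recolour-coloured c x y (just a)
  }
  where
  keep : ∀ u v → Coloured c u v → Coloured (recolour c x y (just a)) u v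
  keep u v col with joins? x y u v
  ... | yes _ = λ ()
  ... | no _  = col

joins-coloured : {c : PartialColouring N K} {x y u v : Fin N} →
  (∀ u v → c u v ≡ c v u) → Coloured c x y → Joins x y u v → Coloured c u v
joins-coloured sym-c col (inj₁ (refl , refl)) = col
joins-coloured sym-c col (inj₂ (refl , refl)) = col ∘ trans (sym-c _ _)

-- Fans

record IsFan (c : PartialColouring N K) (x : Fin N) (z : ℕ → Fin N) (r : ℕ) : Set where
  field
    distinct   : ∀ i j → i ≤ r → j ≤ r → z i ≡ z j → i ≡ j
    avoids     : ∀ i → i ≤ r → z i ≢ x
    uncoloured : c x (z 0) ≡ nothing
    shifted    : ∀ i → i < r → ∃ λ γ → c x (z (suc i)) ≡ just γ × Misses c (z i) γ
open IsFan public

extends-through-shift : {c c′ : PartialColouring N K} {x y₀ y₁ : Fin N} {γ : Fin K} →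
  IsProper c → IsProper c′ → c x y₁ ≡ just γ →
  Extends (recolour (recolour c x y₁ nothing) x y₀ (just γ)) c′ x y₁ → Extends c c′ x y₀
extends-through-shift {c = c} {c′} {x} {y₀} {y₁} {γ} P P′ cxy₁ E = record
  { keeps = keep
  ; adds  = keeps E x y₀ (adds shift)
  ; only  = only′
  }
  where
  c₁ = recolour c x y₁ nothing
  shift = colour-extends {c = c₁} {x} {y₀} γ
  coloured-xy₁ : Coloured c x y₁
  coloured-xy₁ e = just≢nothing (trans (sym cxy₁) e)
  keep : ∀ u v → Coloured c u v → Coloured c′ u v
  keep u v col with joins? x y₁ u v
  ... | yes j  = joins-coloured (symmetric P′) (adds E) j
  ... | no ¬j  = keeps E u v (keeps shift u v (col ∘ trans (sym (recolour-off c x y₁ nothing ¬j))))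
  only′ : ∀ u v → Coloured c′ u v → Coloured c u v ⊎ Joins x y₀ u v
  only′ u v col with only E u v col
  ... | inj₂ j = inj₁ (joins-coloured (symmetric P) coloured-xy₁ j)
  ... | inj₁ col₂ with only shift u v col₂
  ...   | inj₂ j = inj₂ j
  ...   | inj₁ col₁ with recolour-coloured c x y₁ nothing col₁
  ...     | inj₁ col₀ = inj₁ col₀
  ...     | inj₂ j    = inj₁ (joins-coloured (symmetric P) coloured-xy₁ j)

-- Recolour x z(i) with the colour of x z(i+1), for i = 0, …, r − 1, and then x z(r) with δ.
rotate-fan : {c : PartialColouring N K} {x : Fin N} {z : ℕ → Fin N} (r : ℕ) {δ : Fin K} →
  IsProper c → IsFan c x z r → Misses c x δ → Misses c (z r) δ → ProperExtension c x (z 0)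
rotate-fan zero {δ} P F mx mz = _ , colour-proper δ P (avoids F 0 z≤n ∘ sym) mx mz , colour-extends δ
rotate-fan {c = c} {x} {z} (suc r) {δ} P F mx mz =
  let (c′ , P′ , E) = rotate-fan r P₂ F₂ mx₂ mz₂ in c′ , P′ , extends-through-shift P P′ cxz₁ E
  where
  γ = proj₁ (shifted F 0 (s≤s z≤n))
  cxz₁ : c x (z 1) ≡ just γ
  cxz₁ = proj₁ (proj₂ (shifted F 0 (s≤s z≤n)))
  z₀-misses-γ : Misses c (z 0) γ
  z₀-misses-γ = proj₂ (proj₂ (shifted F 0 (s≤s z≤n)))
  c₁ = recolour c x (z 1) nothing
  c₂ = recolour c₁ x (z 0) (just γ)
  apart : ∀ {i j} → i ≤ suc r → j ≤ suc r → i ≢ j → z i ≢ z j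
  apart i≤ j≤ i≢j = i≢j ∘ distinct F _ _ i≤ j≤
  z≢x : ∀ {i} → i ≤ suc r → z i ≢ x
  z≢x = avoids F _
  P₂ : IsProper c₂
  P₂ = colour-proper γ (uncolour-proper x (z 1) P) (z≢x z≤n ∘ sym) (uncolour-frees P cxz₁)
         (recolour-misses c x (z 1) nothing (λ ()) z₀-misses-γ)
  c₂-far : ∀ {i} → 2 ≤ i → i ≤ suc r → c₂ x (z i) ≡ c x (z i)
  c₂-far {suc (suc i)} _ i≤ =
    trans (recolour-off c₁ x (z 0) (just γ) {x} (¬joins-right (z≢x i≤) (apart i≤ z≤n λ ())))
          (recolour-off c x (z 1) nothing {x} (¬joins-right (z≢x i≤) (apart i≤ (s≤s z≤n) λ ())))
  c₂-far {suc zero} (s≤s ())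
  misses₂ : ∀ {i a} → 1 ≤ i → i ≤ suc r → Misses c (z i) a → Misses c₂ (z i) a
  misses₂ {suc i} _ i≤ m = recolour-misses-away c₁ x (z 0) (just γ) (z≢x i≤) (apart i≤ z≤n λ ())
                             (recolour-misses c x (z 1) nothing (λ ()) m)
  F₂ : IsFan c₂ x (z ∘ suc) r
  F₂ = record
    { distinct   = λ i j i≤ j≤ e → ℕ.suc-injective (distinct F _ _ (s≤s i≤) (s≤s j≤) e)
    ; avoids     = λ i i≤ → z≢x (s≤s i≤)
    ; uncoloured = trans (recolour-off c₁ x (z 0) (just γ) {x}
                           (¬joins-right (z≢x (s≤s z≤n)) (apart (s≤s z≤n) z≤n λ ())))
                         (recolour-edge c x (z 1) nothing)
    ; shifted    = λ i i< → let (γ′ , cx , m) = shifted F (suc i) (s≤s i<)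
                            in γ′ , trans (c₂-far (s≤s (s≤s z≤n)) (s≤s i<)) cx
                                  , misses₂ (s≤s z≤n) (ℕ.m≤n⇒m≤1+n i<) m
    }
  γ≢δ : just γ ≢ just δ
  γ≢δ e = mx (z 1) (trans cxz₁ e)
  mx₂ : Misses c₂ x δ
  mx₂ = recolour-misses c₁ x (z 0) (just γ) {x} γ≢δ (recolour-misses c x (z 1) nothing {x} (λ ()) mx)
  mz₂ : Misses c₂ (z (suc r)) δ
  mz₂ = misses₂ (s≤s z≤n) ℕ.≤-refl mz

-- Kempe chains

transpose-left : (i j : Fin K) → transpose i j i ≡ j
transpose-left i j rewrite dec-true (i ≟ i) refl = refl

transpose-other : {i j k : Fin K} → k ≢ i → k ≢ j → transpose i j k ≡ k
transpose-other {i = i} {j} {k} k≢i k≢j rewrite dec-false (k ≟ i) k≢i | dec-false (k ≟ j) k≢j = refl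

transpose-injective : (i j : Fin K) {k l : Fin K} → transpose i j k ≡ transpose i j l → k ≡ l
transpose-injective i j {k} {l} e =
  trans (sym (transpose-inverse j i)) (trans (cong (transpose j i) e) (transpose-inverse j i))

module SwapOn {c : PartialColouring N K} (P : IsProper c) (a b : Fin K)
  {S : Fin N → Set} (S? : ∀ u → Dec (S u))
  (closed : ∀ {u v d} → S u → c u v ≡ just d → d ≡ a ⊎ d ≡ b → S v) where

  τ : Fin K → Fin K
  τ = transpose a b

  swapped : PartialColouring N K
  swapped u v with S? u
  ... | yes _ = Maybe.map τ (c u v)
  ... | no _  = c u v

  swapped-inside : ∀ {u} v → S u → swapped u v ≡ Maybe.map τ (c u v)
  swapped-inside {u} v su with S? u
  ... | yes _ = refl
  ... | no ¬su = ⊥-elim (¬su su)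

  swapped-outside : ∀ {u} v → ¬ S u → swapped u v ≡ c u v
  swapped-outside {u} v ¬su with S? u
  ... | yes su = ⊥-elim (¬su su)
  ... | no _   = refl

  fixed-across : ∀ {u v} → S u → ¬ S v → Maybe.map τ (c u v) ≡ c u v
  fixed-across {u} {v} su ¬sv with c u v in e
  ... | nothing = refl
  ... | just d  = cong just (transpose-other (¬sv ∘ closed su e ∘ inj₁) (¬sv ∘ closed su e ∘ inj₂))

  swapped-symmetric : ∀ u v → swapped u v ≡ swapped v u
  swapped-symmetric u v with S? u | S? v
  ... | yes su | yes sv = cong (Maybe.map τ) (symmetric P u v)
  ... | no ¬su | no ¬sv = symmetric P u v
  ... | yes su | no ¬sv = trans (fixed-across su ¬sv) (symmetric P u v)
  ... | no ¬su | yes sv = trans (symmetric P u v) (sym (fixed-across sv ¬su))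

  untranspose : ∀ {m d} → Maybe.map τ m ≡ just d → m ≡ just (transpose b a d)
  untranspose {just d′} e = cong just (trans (sym (transpose-inverse b a)) (cong (transpose b a) (just-injective e)))

  swapped-proper : IsProper swapped
  swapped-proper = record
    { symmetric   = swapped-symmetric
    ; irreflexive = loop
    ; unique      = uniq
    }
    where
    loop : ∀ u → swapped u u ≡ nothing
    loop u with S? u
    ... | yes _ = cong (Maybe.map τ) (irreflexive P u)
    ... | no _  = irreflexive P u
    uniq : ∀ u v w d → swapped u v ≡ just d → swapped u w ≡ just d → v ≡ w
    uniq u v w d p q = go (S? u)
      where
      go : Dec (S u) → v ≡ w
      go (yes su) = unique P u v w (transpose b a d) (untranspose (trans (sym (swapped-inside v su)) p))
                                                     (untranspose (trans (sym (swapped-inside w su)) q))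
      go (no ¬su) = unique P u v w d (trans (sym (swapped-outside v ¬su)) p) (trans (sym (swapped-outside w ¬su)) q)

  τ-injective : ∀ {k l} → τ k ≡ τ l → k ≡ l
  τ-injective = transpose-injective a b

  uncoloured⇔ : ∀ u v → swapped u v ≡ nothing ⇔ c u v ≡ nothing
  uncoloured⇔ u v with S? u
  ... | yes _ = mk⇔ (map-injective τ-injective) (map-nothing)
  ... | no _  = mk⇔ id id

  swapped-coloured : ∀ u v → Coloured c u v → Coloured swapped u v
  swapped-coloured u v col = col ∘ Equivalence.to (uncoloured⇔ u v)

  swapped-coloured⁻¹ : ∀ u v → Coloured swapped u v → Coloured c u v
  swapped-coloured⁻¹ u v col = col ∘ Equivalence.from (uncoloured⇔ u v)

  misses-inside : ∀ {u d} → S u → Misses c u d → Misses swapped u (τ d)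
  misses-inside su m w e =
    m w (map-injective τ-injective (trans (sym (swapped-inside w su)) e))

  misses-outside : ∀ {u d} → ¬ S u → Misses c u d → Misses swapped u d
  misses-outside ¬su m w e = m w (trans (sym (swapped-outside w ¬su)) e)

module Neighbour {c : PartialColouring N K} (P : IsProper c) where

  neighbour : Fin N → Fin K → Maybe (Fin N)
  neighbour u d with any? (λ w → ≡-dec _≟_ (c u w) (just d))
  ... | yes (w , _) = just w
  ... | no _        = nothing

  neighbour-complete : ∀ {u v d} → c u v ≡ just d → neighbour u d ≡ just v
  neighbour-complete {u} {v} {d} e with any? (λ w → ≡-dec _≟_ (c u w) (just d))
  ... | yes (w , e′) = cong just (unique P u w v d e′ e)
  ... | no ¬∃        = ⊥-elim (¬∃ (v , e))

  neighbour-sound : ∀ {u v d} → neighbour u d ≡ just v → c u v ≡ just d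
  neighbour-sound {u} {v} {d} e with any? (λ w → ≡-dec _≟_ (c u w) (just d))
  neighbour-sound refl | yes (w , e′) = e′

  neighbour-missing : ∀ {u d} → Misses c u d → neighbour u d ≡ nothing
  neighbour-missing {u} {d} m with any? (λ w → ≡-dec _≟_ (c u w) (just d))
  ... | yes (w , e) = ⊥-elim (m w e)
  ... | no _        = refl

  neighbour-missing⁻¹ : ∀ {u d} → neighbour u d ≡ nothing → Misses c u d
  neighbour-missing⁻¹ e w cuw = just≢nothing (trans (sym (neighbour-complete cuw)) e)

alternating : Fin K → Fin K → ℕ → Fin K
alternating a b zero          = b
alternating a b (suc zero)    = a
alternating a b (suc (suc t)) = alternating a b t

module _ {a b : Fin K} (a≢b : a ≢ b) where

  alternating-step : ∀ t → alternating a b (suc t) ≢ alternating a b t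
  alternating-step zero          = a≢b
  alternating-step (suc zero)    = a≢b ∘ sym
  alternating-step (suc (suc t)) = alternating-step t

  alternating-either : ∀ t → alternating a b t ≡ a ⊎ alternating a b t ≡ b
  alternating-either zero          = inj₂ refl
  alternating-either (suc zero)    = inj₁ refl
  alternating-either (suc (suc t)) = alternating-either t

  alternating-other : ∀ t {d} → d ≡ a ⊎ d ≡ b → d ≢ alternating a b (suc t) → d ≡ alternating a b t
  alternating-other zero          (inj₁ refl) d≢ = ⊥-elim (d≢ refl)
  alternating-other zero          (inj₂ refl) d≢ = refl
  alternating-other (suc zero)    (inj₁ refl) d≢ = refl
  alternating-other (suc zero)    (inj₂ refl) d≢ = ⊥-elim (d≢ refl)
  alternating-other (suc (suc t)) d∈         d≢ = alternating-other t d∈ d≢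

-- As x misses a, the (a, b)-chain from x is the walk along colours b, a, b, … starting at x.
module KempeChain {c : PartialColouring N K} (P : IsProper c) (x : Fin N) {a b : Fin K}
  (a≢b : a ≢ b) (x-misses-a : Misses c x a) where
  open Neighbour P

  colour : ℕ → Fin K
  colour = alternating a b

  walk : ℕ → Maybe (Fin N)
  walk zero    = just x
  walk (suc t) = walk t Maybe.>>= λ u → neighbour u (colour t)

  walk-step : ∀ t {u v} → walk t ≡ just u → c u v ≡ just (colour t) → walk (suc t) ≡ just v
  walk-step t e cuv rewrite e = neighbour-complete cuv

  walk-stop : ∀ t {u} → walk t ≡ just u → Misses c u (colour t) → walk (suc t) ≡ nothing
  walk-stop t e m rewrite e = neighbour-missing m

  walk-back : ∀ t {v} → walk (suc t) ≡ just v → ∃ λ u → walk t ≡ just u × c u v ≡ just (colour t)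
  walk-back t e with walk t
  ... | just u = u , refl , neighbour-sound e

  walk-dead : ∀ {t s} → t ≤ s → walk t ≡ nothing → walk s ≡ nothing
  walk-dead {t} {s} t≤s e = subst (λ r → walk r ≡ nothing) (ℕ.m∸n+n≡m t≤s) (go (s ∸ t))
    where
    go : ∀ k → walk (k + t) ≡ nothing
    go zero = e
    go (suc k) rewrite go k = refl

  vertex : ℕ → Fin N
  vertex t = fromMaybe x (walk t)

  module Alive {T : ℕ} (walk-T : walk T ≢ nothing) where

    alive : ∀ {t} → t ≤ T → walk t ≡ just (vertex t)
    alive {t} t≤T with walk t in e
    ... | just _  = refl
    ... | nothing = ⊥-elim (walk-T (walk-dead t≤T e))

    chain-edge : ∀ {t} → t < T → c (vertex t) (vertex (suc t)) ≡ just (colour t)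
    chain-edge {t} t<T with walk-back t (alive t<T)
    ... | u , e , cuv = subst (λ w → c w (vertex (suc t)) ≡ just (colour t))
                              (just-injective (trans (sym e) (alive (ℕ.<⇒≤ t<T)))) cuv

    back-edge : ∀ {t} → t < T → c (vertex (suc t)) (vertex t) ≡ just (colour t)
    back-edge t<T = trans (symmetric P _ _) (chain-edge t<T)

    -- A first repetition v i = v (j+1) would give v i a third chain edge, or x a b-edge besides x v₁.
    vertex-injective : ∀ j → j ≤ T → ∀ i → i < j → vertex i ≢ vertex j
    vertex-injective (suc j) sj≤T i i<sj vi≡vsj with ℕ.m≤n⇒m<n∨m≡n (ℕ.≤-pred i<sj)
    ... | inj₂ refl = just≢nothing (trans (sym (chain-edge sj≤T))
                        (trans (cong (λ u → c u (vertex (suc i))) vi≡vsj) (irreflexive P _)))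
    ... | inj₁ i<j  = revisit i i<j (trans (cong (λ u → c u (vertex j)) vi≡vsj) (back-edge sj≤T))
      where
      j≤T = ℕ.≤-trans (ℕ.n≤1+n j) sj≤T
      earlier : ∀ k → k < j → vertex k ≢ vertex j
      earlier = vertex-injective j j≤T
      colour-j : colour j ≡ a ⊎ colour j ≡ b
      colour-j = alternating-either a≢b j
      revisit : ∀ i → i < j → c (vertex i) (vertex j) ≡ just (colour j) → ⊥
      revisit zero 0<j e with colour-j
      ... | inj₁ ≡a = x-misses-a (vertex j) (trans e (cong just ≡a))
      ... | inj₂ ≡b with ℕ.m≤n⇒m<n∨m≡n 0<j
      ...   | inj₂ refl = a≢b ≡b
      ...   | inj₁ 1<j  = earlier 1 1<j
                            (unique P x (vertex 1) (vertex j) b (chain-edge (ℕ.<-≤-trans 0<j j≤T))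
                                    (trans e (cong just ≡b)))
      revisit (suc i) si<j e with colour j ≟ colour (suc i)
      ... | yes same with ℕ.m≤n⇒m<n∨m≡n si<j
      ...   | inj₂ refl = alternating-step a≢b (suc i) same
      ...   | inj₁ ssi<j = earlier (suc (suc i)) ssi<j
                             (unique P _ _ _ _ (chain-edge (ℕ.<-≤-trans si<j j≤T)) (trans e (cong just same)))
      revisit (suc i) si<j e | no differ =
        earlier i (ℕ.<-trans (ℕ.n<1+n i) si<j)
          (unique P _ _ _ _ (back-edge (ℕ.<-≤-trans (ℕ.<-trans (ℕ.n<1+n i) si<j) j≤T))
                            (trans e (cong just (alternating-other a≢b i colour-j differ))))

  walk-ends : walk (suc N) ≡ nothing
  walk-ends with walk (suc N) in e
  ... | nothing = refl
  ... | just _  with pigeonhole (ℕ.n<1+n N) (vertex ∘ toℕ)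
  ...   | i , j , i<j , same = ⊥-elim (vertex-injective (toℕ j) (ℕ.<⇒≤ (Fin.toℕ<n j)) (toℕ i) i<j same)
    where open Alive {suc N} (λ e′ → just≢nothing (trans (sym e) e′))

  OnChain : Fin N → Set
  OnChain u = ∃ λ (k : Fin (suc N)) → walk (toℕ k) ≡ just u

  onChain? : ∀ u → Dec (OnChain u)
  onChain? u = any? (λ k → ≡-dec _≟_ (walk (toℕ k)) (just u))

  on-chain : ∀ {t u} → t ≤ N → walk t ≡ just u → OnChain u
  on-chain {t} {u} t≤N e =
    fromℕ< (s≤s t≤N) , subst (λ r → walk r ≡ just u) (sym (Fin.toℕ-fromℕ< (s≤s t≤N))) e

  start : OnChain x
  start = on-chain z≤n refl

  closed : ∀ {u v d} → OnChain u → c u v ≡ just d → d ≡ a ⊎ d ≡ b → OnChain v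
  closed (k , e) = go (toℕ k) (ℕ.≤-pred (Fin.toℕ<n k)) e
    where
    go : ∀ t {u v d} → t ≤ N → walk t ≡ just u → c u v ≡ just d → d ≡ a ⊎ d ≡ b → OnChain v
    go t {d = d} t≤N e cuv d∈ with d ≟ colour t
    go t t≤N e cuv d∈ | yes refl with ℕ.m≤n⇒m<n∨m≡n t≤N
    ... | inj₁ t<N = on-chain t<N (walk-step t e cuv)
    ... | inj₂ refl = ⊥-elim (just≢nothing (trans (sym (walk-step t e cuv)) walk-ends))
    go zero t≤N refl cuv (inj₁ refl) | no _ = ⊥-elim (x-misses-a _ cuv)
    go zero t≤N refl cuv (inj₂ refl) | no d≢b = ⊥-elim (d≢b refl)
    go (suc t) t≤N e cuv d∈ | no d≢ with walk-back t e
    ... | u₀ , e₀ , cu₀u = subst OnChain (unique P _ _ _ _ (trans (symmetric P _ _) cu₀u)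
                                            (trans cuv (cong just (alternating-other a≢b t d∈ d≢))))
                                   (on-chain (ℕ.≤-trans (ℕ.n≤1+n t) t≤N) e₀)

  stops-at-b-gap : ∀ t {u} → walk t ≡ just u → u ≢ x → Misses c u b → walk (suc t) ≡ nothing
  stops-at-b-gap zero    refl u≢x _ = ⊥-elim (u≢x refl)
  stops-at-b-gap (suc t) e    u≢x m with walk-back t e
  ... | u₀ , _ , cu₀u = walk-stop (suc t) e (subst (Misses c _) (sym colour-b) m)
    where
    colour-a : colour t ≡ a
    colour-a with alternating-either a≢b t
    ... | inj₁ ≡a = ≡a
    ... | inj₂ ≡b = ⊥-elim (m u₀ (trans (symmetric P _ _) (trans cu₀u (cong just ≡b))))
    colour-b : colour (suc t) ≡ b
    colour-b with alternating-either a≢b (suc t)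
    ... | inj₁ ≡a = ⊥-elim (alternating-step a≢b t (trans ≡a (sym colour-a)))
    ... | inj₂ ≡b = ≡b

  end-unique : ∀ {u u′} → OnChain u → OnChain u′ → u ≢ x → u′ ≢ x →
               Misses c u b → Misses c u′ b → u ≡ u′
  end-unique (k , e) (k′ , e′) u≢x u′≢x m m′ with ℕ.<-cmp (toℕ k) (toℕ k′)
  ... | tri< k<k′ _ _ =
    ⊥-elim (just≢nothing (trans (sym e′) (walk-dead {suc (toℕ k)} k<k′ (stops-at-b-gap (toℕ k) e u≢x m))))
  ... | tri> _ _ k′<k =
    ⊥-elim (just≢nothing (trans (sym e) (walk-dead {suc (toℕ k′)} k′<k (stops-at-b-gap (toℕ k′) e′ u′≢x m′))))
  ... | tri≈ _ k≡k′ _ = just-injective (trans (sym e) (trans (cong walk k≡k′) e′))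

extends-via-same-support : {c c′ c″ : PartialColouring N K} {x y : Fin N} →
  (∀ u v → Coloured c u v → Coloured c′ u v) → (∀ u v → Coloured c′ u v → Coloured c u v) →
  Extends c′ c″ x y → Extends c c″ x y
extends-via-same-support to from E = record
  { keeps = λ u v → keeps E u v ∘ to u v
  ; adds  = adds E
  ; only  = λ u v → map₁ (from u v) ∘ only E u v
  }

-- Vizing's fan argument: grow the fan y₀, y₁, … at x, where x y (i+1) has the colour β (y i)
-- missing at y i, until either β (y i) is missing at x (rotate the fan) or it repeats
-- (swap a Kempe chain first, then rotate).
module FanArgument {c : PartialColouring N K} (P : IsProper c) {x y₀ : Fin N} (x≢y₀ : x ≢ y₀)
  (uncoloured : c x y₀ ≡ nothing) (β : Fin N → Fin K) (β-missing : ∀ u → Misses c u (β u)) where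
  open Neighbour P

  ys : ℕ → Fin N
  ys zero    = y₀
  ys (suc i) = fromMaybe (ys i) (neighbour x (β (ys i)))

  ys-step : ∀ i {w} → neighbour x (β (ys i)) ≡ just w → ys (suc i) ≡ w
  ys-step i e rewrite e = refl

  record FanUpTo (i : ℕ) : Set where
    field
      injective : ∀ p q → p ≤ i → q ≤ i → ys p ≡ ys q → p ≡ q
      edges     : ∀ t → t < i → c x (ys (suc t)) ≡ just (β (ys t))
  open FanUpTo

  avoids-x : ∀ {i} → FanUpTo i → ∀ t → t ≤ i → ys t ≢ x
  avoids-x F zero    _   e = x≢y₀ (sym e)
  avoids-x F (suc t) t<i e = just≢nothing (trans (sym (edges F t t<i)) (trans (cong (c x) e) (irreflexive P x)))

  fan : ∀ {i} → FanUpTo i → IsFan c x ys i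
  fan {i} F = record
    { distinct   = injective F
    ; avoids     = avoids-x F
    ; uncoloured = uncoloured
    ; shifted    = λ t t<i → β (ys t) , edges F t t<i , β-missing (ys t)
    }

  restrict : ∀ {i r} → r ≤ i → FanUpTo i → FanUpTo r
  restrict r≤i F = record
    { injective = λ p q p≤r q≤r → injective F p q (ℕ.≤-trans p≤r r≤i) (ℕ.≤-trans q≤r r≤i)
    ; edges     = λ t t<r → edges F t (ℕ.<-≤-trans t<r r≤i)
    }

  grow-fan : ∀ {i w} → FanUpTo i → neighbour x (β (ys i)) ≡ just w → (∀ q → q ≤ i → ys q ≢ w) →
             FanUpTo (suc i)
  grow-fan {i} F next fresh = record { injective = inj ; edges = edge }
    where
    inj : ∀ p q → p ≤ suc i → q ≤ suc i → ys p ≡ ys q → p ≡ q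
    inj p q p≤ q≤ e with ℕ.m≤n⇒m<n∨m≡n p≤ | ℕ.m≤n⇒m<n∨m≡n q≤
    ... | inj₁ p<     | inj₁ q<     = injective F p q (ℕ.≤-pred p<) (ℕ.≤-pred q<) e
    ... | inj₂ refl   | inj₂ refl   = refl
    ... | inj₂ refl   | inj₁ q<     = ⊥-elim (fresh q (ℕ.≤-pred q<) (trans (sym e) (ys-step i next)))
    ... | inj₁ p<     | inj₂ refl   = ⊥-elim (fresh p (ℕ.≤-pred p<) (trans e (ys-step i next)))
    edge : ∀ t → t < suc i → c x (ys (suc t)) ≡ just (β (ys t))
    edge t t< with ℕ.m≤n⇒m<n∨m≡n (ℕ.≤-pred t<)
    ... | inj₁ t<i  = edges F t t<i
    ... | inj₂ refl = trans (cong (c x) (ys-step t next)) (neighbour-sound next)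

  -- The fan y₀ … y l is blocked because b = β (y l) already colours x y (j+1).  After swapping the
  -- (β x, b)-chain from x, b is missing at x, and at y j or at y l: the chain cannot end at both.
  module Blocked {l j : ℕ} (F : FanUpTo l) (j<l : j < l) (cxy : c x (ys (suc j)) ≡ just (β (ys l))) where
    b = β (ys l)

    α≢b : β x ≢ b
    α≢b α≡b = β-missing x (ys (suc j)) (trans cxy (cong just (sym α≡b)))

    yj-misses-b : Misses c (ys j) b
    yj-misses-b = subst (Misses c (ys j)) (just-injective (trans (sym (edges F j j<l)) cxy)) (β-missing (ys j))

    open KempeChain P x α≢b (β-missing x)
    open SwapOn P (β x) b onChain? closed

    x-misses-b : Misses swapped x b
    x-misses-b = subst (Misses swapped x) (transpose-left (β x) b) (misses-inside start (β-missing x))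

    swapped-misses : ∀ {i} → i < l → (i ≡ j → OnChain (ys j)) → Misses swapped (ys i) (τ (β (ys i)))
    swapped-misses {i} i<l j-on = from (onChain? (ys i))
      where
      ≢α : β (ys i) ≢ β x
      ≢α e = β-missing x _ (trans (edges F i i<l) (cong just e))
      ≢b : ¬ OnChain (ys i) → β (ys i) ≢ b
      ≢b off e with injective F (suc i) (suc j) i<l j<l (unique P x _ _ b (trans (edges F i i<l) (cong just e)) cxy)
      ... | refl = off (j-on refl)
      from : Dec (OnChain (ys i)) → Misses swapped (ys i) (τ (β (ys i)))
      from (yes on) = misses-inside on (β-missing (ys i))
      from (no off) = subst (Misses swapped (ys i)) (sym (transpose-other ≢α (≢b off)))
                            (misses-outside off (β-missing (ys i)))

    swapped-fan : ∀ {r} → r ≤ l → (j < r → OnChain (ys j)) → IsFan swapped x ys r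
    swapped-fan {r} r≤l j-on = record
      { distinct   = injective (restrict r≤l F)
      ; avoids     = λ t t≤r → avoids-x F t (ℕ.≤-trans t≤r r≤l)
      ; uncoloured = trans (swapped-inside y₀ start) (cong (Maybe.map τ) uncoloured)
      ; shifted    = λ i i<r → τ (β (ys i))
                             , trans (swapped-inside _ start) (cong (Maybe.map τ) (edges F i (ℕ.<-≤-trans i<r r≤l)))
                             , swapped-misses (ℕ.<-≤-trans i<r r≤l) (λ { refl → j-on i<r })
      }

    not-both-on-chain : OnChain (ys j) → ¬ OnChain (ys l)
    not-both-on-chain on-j on-l with injective F j l (ℕ.<⇒≤ j<l) ℕ.≤-refl
      (end-unique on-j on-l (avoids-x F j (ℕ.<⇒≤ j<l)) (avoids-x F l ℕ.≤-refl) yj-misses-b (β-missing (ys l)))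
    ... | refl = ℕ.<-irrefl refl j<l

    rotated : ProperExtension swapped x y₀
    rotated with onChain? (ys j)
    ... | no off = rotate-fan j swapped-proper (swapped-fan (ℕ.<⇒≤ j<l) (⊥-elim ∘ ℕ.<-irrefl refl))
                     x-misses-b (misses-outside off yj-misses-b)
    ... | yes on = rotate-fan l swapped-proper (swapped-fan ℕ.≤-refl (λ _ → on))
                     x-misses-b (misses-outside (not-both-on-chain on) (β-missing (ys l)))

    extension : ProperExtension c x y₀
    extension = let (c′ , P′ , E) = rotated
                in c′ , P′ , extends-via-same-support swapped-coloured swapped-coloured⁻¹ E

  grow : ∀ f i → f + i ≡ N → FanUpTo i → ProperExtension c x y₀
  grow zero i refl F with pigeonhole (ℕ.n<1+n N) (ys ∘ toℕ)
  ... | p , q , p<q , same =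
    ⊥-elim (ℕ.<-irrefl (injective F _ _ (ℕ.≤-pred (Fin.toℕ<n p)) (ℕ.≤-pred (Fin.toℕ<n q)) same) p<q)
  grow (suc f) i f+i≡N F with neighbour x (β (ys i)) in next
  ... | nothing = rotate-fan i P (fan F) (neighbour-missing⁻¹ next) (β-missing (ys i))
  ... | just w with any? (λ (k : Fin (suc i)) → ys (toℕ k) ≟ w)
  ...   | yes (k , yk≡w) = repeated (toℕ k) (ℕ.≤-pred (Fin.toℕ<n k)) yk≡w
    where
    repeated : ∀ k → k ≤ i → ys k ≡ w → ProperExtension c x y₀
    repeated zero    _    refl = ⊥-elim (just≢nothing (trans (sym (neighbour-sound next)) uncoloured))
    repeated (suc j) sj≤i yk≡w = Blocked.extension F sj≤i (trans (cong (c x) yk≡w) (neighbour-sound next))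
  ...   | no new = grow f (suc i) (trans (ℕ.+-suc f i) f+i≡N) (grow-fan F next fresh)
    where
    fresh : ∀ q → q ≤ i → ys q ≢ w
    fresh q q≤i e = new (fromℕ< (s≤s q≤i) , trans (cong ys (Fin.toℕ-fromℕ< (s≤s q≤i))) e)

  extension : ProperExtension c x y₀
  extension = grow N 0 (ℕ.+-identityʳ N) record { injective = λ { zero zero _ _ _ → refl } ; edges = λ _ () }

colour-one-more-edge : {c : PartialColouring N K} → IsProper c → ∀ {x y} → x ≢ y → c x y ≡ nothing →
  (β : Fin N → Fin K) → (∀ u → Misses c u (β u)) → ProperExtension c x y
colour-one-more-edge P x≢y uncoloured β β-missing = FanArgument.extension P x≢y uncoloured β β-missing

-- Valency and edge colourings

count : (Fin N → Bool) → ℕ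
count P = sum (tabulate (λ w → if P w then 1 else 0))

degree≡count : (A : Adj N) (v : Fin N) → degree A v ≡ count (A v)
degree≡count A v = cong sum (map-tabulate id (λ w → if A v w then 1 else 0))

count-cong : {P Q : Fin N → Bool} → (∀ w → P w ≡ Q w) → count P ≡ count Q
count-cong {zero}  eq = refl
count-cong {suc N} eq rewrite eq zero = cong (_ +_) (count-cong (eq ∘ suc))

count-true : count {N} (λ _ → true) ≡ N
count-true {zero}  = refl
count-true {suc N} = cong suc count-true

count-false : {P : Fin N → Bool} → (∀ w → P w ≡ false) → count P ≡ 0
count-false {zero}  none = refl
count-false {suc N} none rewrite none zero = count-false (none ∘ suc)

count-remove : (Q : Fin N → Bool) {y : Fin N} → Q y ≡ true →
               count Q ≡ suc (count (λ w → Q w ∧ not (does (w ≟ y))))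
count-remove {suc N} Q {zero} Qy rewrite Qy = cong suc (count-cong λ w → sym (∧-identityʳ (Q (suc w))))
count-remove {suc N} Q {suc y} Qy rewrite ∧-identityʳ (Q zero) =
  trans (cong (q₀ +_) (count-remove (Q ∘ suc) Qy)) (ℕ.+-suc q₀ _)
  where q₀ = if Q zero then 1 else 0

count-single : (P : Fin N → Bool) {y : Fin N} → P y ≡ true → (∀ w → P w ≡ true → w ≡ y) → count P ≡ 1
count-single P {y} Py only = trans (count-remove P Py) (cong suc (count-false rest))
  where
  rest : ∀ w → P w ∧ not (does (w ≟ y)) ≡ false
  rest w with P w in e
  ... | false = refl
  ... | true rewrite only w e | dec-true (y ≟ y) refl = refl

count-∨ : (P Q : Fin N → Bool) → (∀ w → P w ≡ true → Q w ≡ false) →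
          count (λ w → P w ∨ Q w) ≡ count P + count Q
count-∨ {zero}  P Q disjoint = refl
count-∨ {suc N} P Q disjoint with P zero in e
... | true rewrite disjoint zero e = cong suc (count-∨ (P ∘ suc) (Q ∘ suc) (disjoint ∘ suc))
... | false = trans (cong (_ +_) (count-∨ (P ∘ suc) (Q ∘ suc) (disjoint ∘ suc)))
                    (x∙yz≈y∙xz (if Q zero then 1 else 0) (count (P ∘ suc)) _)

count-injection : ∀ {m} (P : Fin N → Bool) (Q : Fin m → Bool) (f : ∀ w → P w ≡ true → Fin m) →
  (∀ w p → Q (f w p) ≡ true) → (∀ w w′ p p′ → f w p ≡ f w′ p′ → w ≡ w′) → count P ≤ count Q
count-injection {zero}  P Q f into inj = z≤n
count-injection {suc N} P Q f into inj with P zero in e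
... | false = count-injection (P ∘ suc) Q (f ∘ suc) (into ∘ suc) inj′
  where
  inj′ = λ w w′ p p′ → Fin.suc-injective ∘ inj (suc w) (suc w′) p p′
... | true  = subst (suc (count (P ∘ suc)) ≤_) (sym (count-remove Q (into zero e)))
                (s≤s (count-injection (P ∘ suc) Q′ (f ∘ suc) into′ inj′))
  where
  inj′ = λ w w′ p p′ → Fin.suc-injective ∘ inj (suc w) (suc w′) p p′
  y = f zero e
  Q′ : _ → Bool
  Q′ w = Q w ∧ not (does (w ≟ y))
  into′ : ∀ w p → Q′ (f (suc w) p) ≡ true
  into′ w p rewrite into (suc w) p with f (suc w) p ≟ y
  ... | no _ = refl
  ... | yes same with inj (suc w) zero p e same
  ...   | ()

max-tabulate-upper : (f : Fin N → ℕ) (w : Fin N) → f w ≤ foldr _⊔_ 0 (tabulate f)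
max-tabulate-upper f zero    = ℕ.m≤m⊔n _ _
max-tabulate-upper f (suc w) = ℕ.≤-trans (max-tabulate-upper (f ∘ suc) w) (ℕ.m≤n⊔m _ _)

max-tabulate-least : (f : Fin N → ℕ) {D : ℕ} → (∀ w → f w ≤ D) → foldr _⊔_ 0 (tabulate f) ≤ D
max-tabulate-least {zero}  f bounded = z≤n
max-tabulate-least {suc N} f bounded = ℕ.⊔-lub (bounded zero) (max-tabulate-least (f ∘ suc) (bounded ∘ suc))

maxValency≡ : (A : Adj N) → maxValency A ≡ foldr _⊔_ 0 (tabulate (degree A))
maxValency≡ A = cong (foldr _⊔_ 0) (map-tabulate id (degree A))

degree≤maxValency : (A : Adj N) (w : Fin N) → degree A w ≤ maxValency A
degree≤maxValency A w = subst (degree A w ≤_) (sym (maxValency≡ A)) (max-tabulate-upper (degree A) w)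

maxValency-least : (A : Adj N) {D : ℕ} → (∀ w → degree A w ≤ D) → maxValency A ≤ D
maxValency-least A bounded = subst (_≤ _) (sym (maxValency≡ A)) (max-tabulate-least (degree A) bounded)

module _ {A : Adj N} where
  open EdgeColouring

  colouring-inject≤ : ∀ {k k′} → EdgeColouring A k → k ≤ k′ → EdgeColouring A k′
  colouring-inject≤ ec k≤k′ = record
    { col     = λ u v p → inject≤ (col ec u v p) k≤k′
    ; col-sym = λ v w p q → cong (λ i → inject≤ i k≤k′) (col-sym ec v w p q)
    ; proper  = λ u v w p q v≢w → proper ec u v w p q v≢w ∘ inject≤-injective k≤k′ k≤k′ _ _
    }

  edgeless-colouring : ∀ {k} → (∀ u v → A u v ≡ true → ⊥) → EdgeColouring A k
  edgeless-colouring no-edge = record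
    { col     = λ u v p → ⊥-elim (no-edge u v p)
    ; col-sym = λ v w p q → ⊥-elim (no-edge v w p)
    ; proper  = λ u v w p q _ _ → no-edge u v p
    }

  degree≤colours : ∀ {k} → EdgeColouring A k → ∀ u → degree A u ≤ k
  degree≤colours {k} ec u = subst₂ _≤_ (sym (degree≡count A u)) count-true
    (count-injection (A u) (λ _ → true) (col ec u) (λ _ _ → refl) injective)
    where
    injective : ∀ v w p q → col ec u v p ≡ col ec u w q → v ≡ w
    injective v w p q same with v ≟ w
    ... | yes v≡w = v≡w
    ... | no v≢w  = ⊥-elim (proper ec u v w p q v≢w same)

  maxValency≤colours : ∀ {k} → EdgeColouring A k → maxValency A ≤ k
  maxValency≤colours ec = maxValency-least A (degree≤colours ec)

-- Vizing's theorem

module Vizing {A : Adj N} (simple : IsSimple A) (D : ℕ) (bounded : ∀ w → degree A w ≤ D) where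

  Within : PartialColouring N (suc D) → Set
  Within c = ∀ u v → Coloured c u v → A u v ≡ true

  -- u has at most D neighbours, so one of the D + 1 colours is free at u.
  missing-colour : ∀ {c} → IsProper c → Within c → ∀ u → ∃ (Misses c u)
  missing-colour {c} P within u with any? (λ d → all? (λ w → ¬? (≡-dec _≟_ (c u w) (just d))))
  ... | yes found = found
  ... | no none   = ⊥-elim (ℕ.<-irrefl refl (ℕ.≤-trans colours≤degree (bounded u)))
    where
    present : ∀ d → ∃ λ w → c u w ≡ just d
    present d with ¬∀⟶∃¬ N _ (λ w → ¬? (≡-dec _≟_ (c u w) (just d))) (λ m → none (d , m))
    ... | w , ¬¬cuw = w , decidable-stable (≡-dec _≟_ (c u w) (just d)) ¬¬cuw
    colours≤degree : suc D ≤ degree A u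
    colours≤degree = subst₂ _≤_ count-true (sym (degree≡count A u))
      (count-injection (λ _ → true) (A u) (λ d _ → proj₁ (present d))
        (λ d _ → within u _ (λ e → just≢nothing (trans (sym (proj₂ (present d))) e)))
        (λ d d′ _ _ e → just-injective (trans (sym (proj₂ (present d)))
                                               (trans (cong (c u) e) (proj₂ (present d′))))))

  ColoursAll : List (Fin N × Fin N) → Set
  ColoursAll L = ∃ λ c → IsProper c × Within c × (∀ u v → (u , v) ∈ L → A u v ≡ true → Coloured c u v)

  colour-pairs : ∀ L → ColoursAll L
  colour-pairs [] = (λ _ _ → nothing)
                  , record { symmetric = λ _ _ → refl ; irreflexive = λ _ → refl ; unique = λ _ _ _ _ () }
                  , (λ u v col → ⊥-elim (col refl))
                  , (λ u v ())
  colour-pairs ((u , v) ∷ L) with colour-pairs L | A u v in edge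
  ... | c , P , within , covers | false = c , P , within , covers′
    where
    covers′ : ∀ s t → (s , t) ∈ (u , v) ∷ L → A s t ≡ true → Coloured c s t
    covers′ s t (here refl) e with trans (sym edge) e
    ... | ()
    covers′ s t (there st∈L) e = covers s t st∈L e
  ... | c , P , within , covers | true with c u v in cuv
  ...   | just a = c , P , within , covers′
    where
    covers′ : ∀ s t → (s , t) ∈ (u , v) ∷ L → A s t ≡ true → Coloured c s t
    covers′ s t (here refl) _ e = just≢nothing (trans (sym cuv) e)
    covers′ s t (there st∈L) e = covers s t st∈L e
  ...   | nothing =
    let (c′ , P′ , E) = colour-one-more-edge P u≢v cuv (proj₁ ∘ missing-colour P within)
                                                     (proj₂ ∘ missing-colour P within)
    in c′ , P′ , within′ E , covers′ E
    where
    u≢v : u ≢ v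
    u≢v refl with trans (sym edge) (proj₂ simple u)
    ... | ()
    within′ : ∀ {c′} → Extends c c′ u v → Within c′
    within′ E s t col with only E s t col
    ... | inj₁ col₀ = within s t col₀
    ... | inj₂ (inj₁ (refl , refl)) = edge
    ... | inj₂ (inj₂ (refl , refl)) = trans (proj₁ simple s t) edge
    covers′ : ∀ {c′} → Extends c c′ u v →
              ∀ s t → (s , t) ∈ (u , v) ∷ L → A s t ≡ true → Coloured c′ s t
    covers′ E s t (here refl) _ = adds E
    covers′ E s t (there st∈L) e = keeps E s t (covers s t st∈L e)

  colouring : EdgeColouring A (suc D)
  colouring = record { col = col ; col-sym = col-sym ; proper = proper }
    where
    c = proj₁ (colour-pairs (cartesianProduct (allFin N) (allFin N)))
    P = proj₁ (proj₂ (colour-pairs (cartesianProduct (allFin N) (allFin N))))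
    covers : ∀ u v → A u v ≡ true → Coloured c u v
    covers u v = proj₂ (proj₂ (proj₂ (colour-pairs _))) u v (∈-cartesianProduct⁺ (∈-allFin u) (∈-allFin v))
    col : ∀ u v → A u v ≡ true → Fin (suc D)
    col u v _ = fromMaybe zero (c u v)
    col-sym : ∀ v w (p : A v w ≡ true) (q : A w v ≡ true) → col v w p ≡ col w v q
    col-sym v w _ _ = cong (fromMaybe zero) (symmetric P v w)
    colour-of : ∀ {u v} → Coloured c u v → c u v ≡ just (fromMaybe zero (c u v))
    colour-of {u} {v} col with c u v
    ... | just _  = refl
    ... | nothing = ⊥-elim (col refl)
    proper : ∀ u v w (p : A u v ≡ true) (q : A u w ≡ true) → v ≢ w → col u v p ≢ col u w q
    proper u v w p q v≢w same = v≢w (unique P u v w _ (colour-of (covers u v p))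
                                                     (trans (colour-of (covers u w q)) (cong just (sym same))))

vizing : {A : Adj N} → IsSimple A → ∀ D → (∀ w → degree A w ≤ D) → EdgeColouring A (suc D)
vizing simple D bounded = Vizing.colouring simple D bounded

vizing-< : {A : Adj N} → IsSimple A → ∀ k → (∀ u v → A u v ≡ true → degree A u < k) → EdgeColouring A k
vizing-< simple zero    small = edgeless-colouring (λ u v p → ℕ.n≮0 (small u v p))
vizing-< {A = A} simple (suc k) small = vizing simple k bounded
  where
  bounded : ∀ u → degree A u ≤ k
  bounded u with any? (λ w → A u w Bool.≟ true)
  ... | yes (w , p) = ℕ.≤-pred (small u w p)
  ... | no isolated = subst (_≤ k) (sym (trans (degree≡count A u) (count-false no-edge))) z≤n
    where
    no-edge : ∀ w → A u w ≡ false
    no-edge w with A u w in e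
    ... | false = refl
    ... | true  = ⊥-elim (isolated (w , e))

-- Generalized truncations

module _ {A B : Adj N} where
  open EdgeColouring

  colouring-cong : (∀ u v → A u v ≡ B u v) → EdgeColouring A k → EdgeColouring B k
  colouring-cong A≡B ec = record
    { col     = λ u v p → col ec u v (trans (A≡B u v) p)
    ; col-sym = λ v w p q → col-sym ec v w _ _
    ; proper  = λ u v w p q → proper ec u v w _ _
    }

module _ {M C : Adj N} (M-symmetric : ∀ u v → M u v ≡ M v u)
  (M-matching : ∀ u v w → M u v ≡ true → M u w ≡ true → v ≡ w)
  (disjoint : ∀ u v → M u v ≡ true → C u v ≡ false) where
  open EdgeColouring

  colouring-with-matching : EdgeColouring C k → EdgeColouring (λ u v → M u v ∨ C u v) (suc k)
  colouring-with-matching {k} ec = record { col = col′ ; col-sym = col-sym′ ; proper = proper′ }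
    where
    col′ : ∀ u v → M u v ∨ C u v ≡ true → Fin (suc k)
    col′ u v p with M u v
    ... | true  = fromℕ k
    ... | false = inject₁ (col ec u v p)
    asymmetric : ∀ {v w} → M v w ≡ true → M w v ≡ false → ⊥
    asymmetric e e′ with trans (sym e) (trans (M-symmetric _ _) e′)
    ... | ()
    col-sym′ : ∀ v w (p : M v w ∨ C v w ≡ true) (q : M w v ∨ C w v ≡ true) → col′ v w p ≡ col′ w v q
    col-sym′ v w p q with M v w in e | M w v in e′
    ... | true  | true  = refl
    ... | false | false = cong inject₁ (col-sym ec v w p q)
    ... | true  | false = ⊥-elim (asymmetric e e′)
    ... | false | true  = ⊥-elim (asymmetric e′ e)
    proper′ : ∀ u v w (p : M u v ∨ C u v ≡ true) (q : M u w ∨ C u w ≡ true) →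
              v ≢ w → col′ u v p ≢ col′ u w q
    proper′ u v w p q v≢w with M u v in e | M u w in e′
    ... | true  | true  = λ _ → v≢w (M-matching u v w e e′)
    ... | true  | false = fromℕ≢inject₁
    ... | false | true  = fromℕ≢inject₁ ∘ sym
    ... | false | false = proper ec u v w p q v≢w ∘ inject₁-injective

any-allFin-unique : (P : Fin N → Bool) {v₀ : Fin N} → (∀ v → P v ≡ true → v ≡ v₀) →
                    any P (allFin N) ≡ P v₀
any-allFin-unique P {v₀} only with P v₀ in e
... | true  = Equivalence.to T-≡ (any⁺ P (Any.map (λ { refl → Equivalence.from T-≡ e }) (∈-allFin v₀)))
... | false with any P (allFin _) in e′
...   | false = refl
...   | true with satisfied (any⁻ P (allFin _) (Equivalence.from T-≡ e′))
...     | v , Pv with only v (Equivalence.to T-≡ Pv)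
...       | refl with trans (sym e) (Equivalence.to T-≡ Pv)
...         | ()

⌊≟⌋-sym : (i j : Fin N) → ⌊ i ≟ j ⌋ ≡ ⌊ j ≟ i ⌋
⌊≟⌋-sym i j =
  trans (isYes≗does (i ≟ j)) (trans (does-⇔ (mk⇔ sym sym) (i ≟ j) (j ≟ i)) (sym (isYes≗does (j ≟ i))))

matchS-sound : (s s′ : Fin N ⊎ Fin N) → matchS s s′ ≡ true → s′ ≡ swap s
matchS-sound (inj₁ e) (inj₂ e′) p = cong inj₂ (sym (toWitness (Equivalence.from T-≡ p)))
matchS-sound (inj₂ e) (inj₁ e′) p = cong inj₁ (sym (toWitness (Equivalence.from T-≡ p)))

matchS-swap : (s : Fin N ⊎ Fin N) → matchS s (swap s) ≡ true
matchS-swap (inj₁ e) = trans (isYes≗does (e ≟ e)) (dec-true (e ≟ e) refl)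
matchS-swap (inj₂ e) = trans (isYes≗does (e ≟ e)) (dec-true (e ≟ e) refl)

matchS-sym : (s s′ : Fin N ⊎ Fin N) → matchS s s′ ≡ matchS s′ s
matchS-sym (inj₁ e) (inj₁ e′) = refl
matchS-sym (inj₁ e) (inj₂ e′) = ⌊≟⌋-sym e e′
matchS-sym (inj₂ e) (inj₁ e′) = ⌊≟⌋-sym e e′
matchS-sym (inj₂ e) (inj₂ e′) = refl

module Truncation (X : Multigraph) (T : GenTrunc X) where
  open EdgeColouring

  partner : Fin (Dart X) → Fin (Dart X)
  partner d = join (m X) (m X) (swap (splitAt (m X) d))

  matching-symmetric : ∀ d d′ → matching X d d′ ≡ matching X d′ d
  matching-symmetric d d′ = matchS-sym (splitAt (m X) d) (splitAt (m X) d′)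

  matching⇒partner : ∀ {d d′} → matching X d d′ ≡ true → d′ ≡ partner d
  matching⇒partner {d} {d′} p =
    trans (sym (join-splitAt (m X) (m X) d′))
          (cong (join (m X) (m X)) (matchS-sound (splitAt (m X) d) (splitAt (m X) d′) p))

  matching-partner : ∀ d → matching X d (partner d) ≡ true
  matching-partner d rewrite splitAt-join (m X) (m X) (swap (splitAt (m X) d)) = matchS-swap (splitAt (m X) d)

  label-partner : ∀ d → label X (partner d) ≢ label X d
  label-partner d rewrite splitAt-join (m X) (m X) (swap (splitAt (m X) d)) = ends-differ (splitAt (m X) d)
    where
    ends-differ : ∀ s → [ src X , tgt X ] (swap s) ≢ [ src X , tgt X ] s
    ends-differ (inj₁ e) = loopless X e ∘ sym
    ends-differ (inj₂ e) = loopless X e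

  Constituents : Adj (Dart X)
  Constituents d d′ = con T (label X d) d d′

  TR≡ : ∀ d d′ → TR X T d d′ ≡ matching X d d′ ∨ Constituents d d′
  TR≡ d d′ = cong (matching X d d′ ∨_)
    (any-allFin-unique (λ v → con T v d d′) (λ v p → sym (proj₁ (con-supp T v d d′ p))))

  matching-disjoint : ∀ d d′ → matching X d d′ ≡ true → Constituents d d′ ≡ false
  matching-disjoint d d′ p with Constituents d d′ in e
  ... | false = refl
  ... | true  = ⊥-elim (label-partner d (trans (cong (label X) (sym (matching⇒partner p)))
                                               (proj₂ (con-supp T _ d d′ e))))

  degree-TR : ∀ d → degree (TR X T) d ≡ suc (degree (con T (label X d)) d)
  degree-TR d = begin
    degree (TR X T) d                                    ≡⟨ degree≡count (TR X T) d ⟩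
    count (TR X T d)                                     ≡⟨ count-cong (TR≡ d) ⟩
    count (λ d′ → matching X d d′ ∨ Constituents d d′)   ≡⟨ count-∨ _ _ (matching-disjoint d) ⟩
    count (matching X d) ℕ.+ count (Constituents d)      ≡⟨ cong (ℕ._+ count (Constituents d)) one-partner ⟩
    suc (count (Constituents d))                         ≡⟨ cong suc (sym (degree≡count (con T (label X d)) d)) ⟩
    suc (degree (con T (label X d)) d)                   ∎
    where
    open ≡-Reasoning
    one-partner : count (matching X d) ≡ 1
    one-partner = count-single (matching X d) (matching-partner d) (λ _ → matching⇒partner)

  degree-con-outside : ∀ {v d} → label X d ≢ v → degree (con T v) d ≡ 0
  degree-con-outside {v} {d} d∉v = trans (degree≡count (con T v) d) (count-false no-edge)
    where
    no-edge : ∀ d′ → con T v d d′ ≡ false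
    no-edge d′ with con T v d d′ in e
    ... | false = refl
    ... | true  = ⊥-elim (d∉v (proj₁ (con-supp T v d d′ e)))

  constituents-colouring : (∀ v → EdgeColouring (con T v) k) → EdgeColouring Constituents k
  constituents-colouring ec = record
    { col     = λ d d′ → col (ec (label X d)) d d′
    ; col-sym = col-sym′
    ; proper  = λ d → proper (ec (label X d)) d
    }
    where
    moved : ∀ {v v′} → v ≡ v′ → ∀ {d d′} → con T v d d′ ≡ true → con T v′ d d′ ≡ true
    moved e {d} {d′} = subst (λ v → con T v d d′ ≡ true) e
    same-cluster : ∀ {v v′} (e : v ≡ v′) {d d′} (p : con T v d d′ ≡ true) →
                   col (ec v) d d′ p ≡ col (ec v′) d d′ (moved e p)
    same-cluster refl p = refl
    col-sym′ : ∀ d d′ (p : Constituents d d′ ≡ true) (q : Constituents d′ d ≡ true) →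
               col (ec (label X d)) d d′ p ≡ col (ec (label X d′)) d′ d q
    col-sym′ d d′ p q = trans (same-cluster label≡ p) (col-sym (ec (label X d′)) d d′ (moved label≡ p) q)
      where
      label≡ : label X d ≡ label X d′
      label≡ = sym (proj₂ (con-supp T _ d d′ p))

module TruncationColouring (X : Multigraph) (T : GenTrunc X)
  (class-I : ∀ v → (∃ λ d → (label X d ≡ v) × (degree (TR X T) d ≡ maxValency (TR X T))) → ClassI (con T v))
  (D : ℕ) (Δ≡ : maxValency (TR X T) ≡ suc D) where
  open Truncation X T

  degree-TR≤ : ∀ d → suc (degree (con T (label X d)) d) ≤ suc D
  degree-TR≤ d = subst₂ _≤_ (degree-TR d) Δ≡ (degree≤maxValency (TR X T) d)

  con-degree≤ : ∀ v d → degree (con T v) d ≤ D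
  con-degree≤ v d with label X d ≟ v
  ... | yes refl = ℕ.≤-pred (degree-TR≤ d)
  ... | no d∉v   = subst (_≤ D) (sym (degree-con-outside d∉v)) z≤n

  con-degree< : ∀ {v} → ¬ (∃ λ d → (label X d ≡ v) × (degree (TR X T) d ≡ maxValency (TR X T))) →
                ∀ d → label X d ≡ v → degree (con T v) d < D
  con-degree< no-Δ d refl =
    ℕ.≤-pred (ℕ.≤∧≢⇒< (degree-TR≤ d) λ e → no-Δ (d , refl , trans (degree-TR d) (trans e (sym Δ≡))))

  con-colouring : ∀ v → EdgeColouring (con T v) D
  con-colouring v with any? (λ d → (label X d ≟ v) ×-dec (degree (TR X T) d ℕ.≟ maxValency (TR X T)))
  ... | yes has-Δ = colouring-inject≤ (proj₁ (class-I v has-Δ)) (maxValency-least (con T v) (con-degree≤ v))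
  ... | no no-Δ   = vizing-< (con-simple T v) D (λ d d′ p → con-degree< no-Δ d (proj₁ (con-supp T v d d′ p)))

  colouring : EdgeColouring (TR X T) (suc D)
  colouring = colouring-cong (λ d d′ → sym (TR≡ d d′))
    (colouring-with-matching matching-symmetric
      (λ d _ _ p q → trans (matching⇒partner p) (sym (matching⇒partner q))) matching-disjoint
      (constituents-colouring con-colouring))

theorem6p1 : (X : Multigraph) → NoIsolatedVertices X → (T : GenTrunc X) →
    (∀ v → (∃ λ d → (label X d ≡ v) × (degree (TR X T) d ≡ maxValency (TR X T))) →
    ClassI (con T v)) →
    ClassI (TR X T)
theorem6p1 X _ T class-I = colouring _ refl , λ _ → maxValency≤colours
  where
  open Truncation X T
  colouring : ∀ Δ → maxValency (TR X T) ≡ Δ → EdgeColouring (TR X T) Δ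
  colouring zero    Δ≡0 = edgeless-colouring λ d _ _ →
    ℕ.n≮0 (subst₂ _≤_ (degree-TR d) Δ≡0 (degree≤maxValency (TR X T) d))
  colouring (suc D) Δ≡  = TruncationColouring.colouring X T class-I D Δ≡
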